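{- Let $A$ and $B$ be two disjoint bases of a matroid $M$. Let $a_1,a_2\in A$ with $a_1\neq a_2$, and $b_1,b_2\in B$. Suppose $B'=B-b_1+a_1$ is a base and either $b_2\notin C(B,a_1)$ or $b_1\notin C(B,a_2)$. Then $b_2\in C(B',a_2)$ if and only if $b_2\in C(B,a_2)$.
   Context: Notation: $B-b_1+a_1=(B\setminus\{b_1\})\cup\{a_1\}$. For an independent set $I$ and an element $x$ such that $I\cup\{x\}$ is dependent, $C(I,x)$ denotes the unique minimal subset of $I$ that spans $x$ (equivalently, $C(I,x)\cup\{x\}$ is the unique circuit contained in $I\cup\{x\}$, and $C(I,x)$ is this circuit minus $x$). -}

module Defs where

open import Data.Nat using (ℕ; _<_)
open import Data.Fin using (Fin)
open import Data.Fin.Subset using (Subset; _∈_; _∉_; _⊆_; _⊂_; _∪_; _-_; ⁅_⁆; ∣_∣; ⊥)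
open import Data.Product using (Σ; _×_; ∃)
open import Relation.Nullary using (¬_)
open import Level using (Level; suc; _⊔_)

record Matroid (ℓ : Level) (n : ℕ) : Set (suc ℓ) where
  field
    Indep        : Subset n → Set ℓ
    indep-empty  : Indep ⊥
    indep-subset : ∀ {I J} → J ⊆ I → Indep I → Indep J
    indep-augment : ∀ {I J} → Indep I → Indep J → ∣ I ∣ < ∣ J ∣ →
                    ∃ λ x → x ∈ J × x ∉ I × Indep (I ∪ ⁅ x ⁆)

module _ {ℓ : Level} {n : ℕ} (M : Matroid ℓ n) where
  open Matroid M

  Dependent : Subset n → Set ℓ
  Dependent X = ¬ Indep X

  IsBase : Subset n → Set ℓ
  IsBase B = Indep B × (∀ x → x ∉ B → Dependent (B ∪ ⁅ x ⁆))

  IsCircuit : Subset n → Set ℓ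
  IsCircuit C = Dependent C × (∀ D → D ⊂ C → Indep D)

  -- FundCircuit I x C  :  C = C(I,x), i.e. C ⊆ I, x ∉ C, and C ∪ {x} is a circuit
  -- (the unique circuit contained in I ∪ {x}).
  FundCircuit : Subset n → Fin n → Subset n → Set ℓ
  FundCircuit I x C = C ⊆ I × x ∉ C × IsCircuit (C ∪ ⁅ x ⁆)

Disjoint : ∀ {n} → Subset n → Subset n → Set
Disjoint A B = ∀ x → x ∈ A → x ∉ B

-- Write I [ y ↦ x ] for (I - y) ∪ {x}. For independent I, y ∈ C(I, x) iff I [ y ↦ x ] is
-- independent, so with B′ = B [ b₁ ↦ a₁ ] the claim is that B [ b₂ ↦ a₂ ] and
-- B′ [ b₂ ↦ a₂ ] are independent together. If b₁ ∉ C(B, a₂), then C(B, a₂) ⊆ B′ is also the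
-- fundamental circuit of a₂ in B′. Otherwise b₂ ∉ C(B, a₁), so B [ b₂ ↦ a₁ ] is dependent.
-- The independent sets B - b₂ and B′ - b₂ have equal size and differ only in b₁ versus a₁;
-- augmenting either one from the other's exchange by a₂ adds a₂ or else a₁ (resp. b₁), and
-- the latter would make B [ b₂ ↦ a₁ ] independent.
module Submission where

open import Defs
open import Level using (Level)
open import Data.Nat using (ℕ; suc; zero; _≤_; _+_)
open import Data.Nat.Properties using (≤-reflexive; suc-injective; <⇒≱; ≰⇒>; m≤n+m; +-identityʳ; +-suc; _≤?_)
open import Data.Fin as Fin using (Fin; _≟_)
open import Data.Fin.Subset using (Subset; _∈_; _∉_; _∪_; _-_; ⁅_⁆; _⊆_; _─_; ∣_∣; inside; outside)
open import Data.Fin.Subset.Properties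
  using (_∈?_; x∈p∪q⁺; x∈p∪q⁻; x∈⁅x⁆; x∈⁅y⁆⇒x≡y; x∈p∧x≢y⇒x∈p-y; p─q⊆p; p⊆p∪q; ⊆-refl; ⊆-trans;
         p⊂q⇒∣p∣<∣q∣; x∈p⇒p-x⊂p; ∪-identityʳ; p─⊥≡p)
open import Data.Vec.Base using (_∷_; here; there)
open import Data.Product using (∃; _×_; _,_)
open import Data.Sum using (_⊎_; inj₁; inj₂)
open import Data.Empty using (⊥-elim)
open import Function.Bundles using (_⇔_; mk⇔; Equivalence)
open import Function.Properties.Equivalence using () renaming (trans to ⇔-trans; sym to ⇔-sym)
open import Relation.Nullary using (yes; no)
open import Relation.Binary.PropositionalEquality using (_≡_; _≢_; refl; sym; trans; cong; subst)
open import Relation.Binary.PropositionalEquality.Properties using (module ≡-Reasoning)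

private variable
  n : ℕ

_[_↦_] : Subset n → Fin n → Fin n → Subset n
I [ y ↦ x ] = (I - y) ∪ ⁅ x ⁆

x∈p─q⇒x∉q : ∀ {x : Fin n} (p q : Subset n) → x ∈ p ─ q → x ∉ q
x∈p─q⇒x∉q (_ ∷ p) (inside  ∷ q) (there x∈) (there x∈q) = x∈p─q⇒x∉q p q x∈ x∈q
x∈p─q⇒x∉q (_ ∷ p) (outside ∷ q) (there x∈) (there x∈q) = x∈p─q⇒x∉q p q x∈ x∈q

x∈p-y⇒x≢y : ∀ {x y : Fin n} (p : Subset n) → x ∈ p - y → x ≢ y
x∈p-y⇒x≢y {y = y} p x∈ refl = x∈p─q⇒x∉q p ⁅ y ⁆ x∈ (x∈⁅x⁆ y)

x∈p-y⇒x∈p : ∀ {x y : Fin n} (p : Subset n) → x ∈ p - y → x ∈ p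
x∈p-y⇒x∈p {y = y} p = p─q⊆p p ⁅ y ⁆

x∈p∪⁅y⁆⁻ : ∀ {x y : Fin n} (p : Subset n) → x ∈ p ∪ ⁅ y ⁆ → x ∈ p ⊎ x ≡ y
x∈p∪⁅y⁆⁻ {y = y} p x∈ with x∈p∪q⁻ p ⁅ y ⁆ x∈
... | inj₁ x∈p = inj₁ x∈p
... | inj₂ x∈y = inj₂ (x∈⁅y⁆⇒x≡y y x∈y)

y∈p∪⁅y⁆ : ∀ {y : Fin n} {p : Subset n} → y ∈ p ∪ ⁅ y ⁆
y∈p∪⁅y⁆ {y = y} = x∈p∪q⁺ (inj₂ (x∈⁅x⁆ y))

p⊆q∧x∈q⇒p∪⁅x⁆⊆q : ∀ {p q : Subset n} {x : Fin n} → p ⊆ q → x ∈ q → p ∪ ⁅ x ⁆ ⊆ q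
p⊆q∧x∈q⇒p∪⁅x⁆⊆q {p = p} p⊆q x∈q w∈ with x∈p∪⁅y⁆⁻ p w∈
... | inj₁ w∈p = p⊆q w∈p
... | inj₂ refl = x∈q

p⊆q∧y∉p⇒p⊆q-y : ∀ {p q : Subset n} {y : Fin n} → p ⊆ q → y ∉ p → p ⊆ q - y
p⊆q∧y∉p⇒p⊆q-y p⊆q y∉p w∈p = x∈p∧x≢y⇒x∈p-y (p⊆q w∈p) λ { refl → y∉p w∈p }

p-y⊆q∧y∈q⇒p⊆q : ∀ {p q : Subset n} {y : Fin n} → p - y ⊆ q → y ∈ q → p ⊆ q
p-y⊆q∧y∈q⇒p⊆q {y = y} p-y⊆q y∈q {w} w∈p with w ≟ y
... | yes refl = y∈q
... | no w≢y = p-y⊆q (x∈p∧x≢y⇒x∈p-y w∈p w≢y)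

p⊆q∧y∉p⇒p∪⁅x⁆⊆q[y↦x] : ∀ {p q : Subset n} {x y : Fin n} → p ⊆ q → y ∉ p → p ∪ ⁅ x ⁆ ⊆ q [ y ↦ x ]
p⊆q∧y∉p⇒p∪⁅x⁆⊆q[y↦x] p⊆q y∉p =
  p⊆q∧x∈q⇒p∪⁅x⁆⊆q (⊆-trans (p⊆q∧y∉p⇒p⊆q-y p⊆q y∉p) (p⊆p∪q _)) y∈p∪⁅y⁆

p-y⊆p[z↦x]-y∪⁅z⁆ : ∀ (p : Subset n) {x y z : Fin n} → p - y ⊆ (p [ z ↦ x ] - y) ∪ ⁅ z ⁆
p-y⊆p[z↦x]-y∪⁅z⁆ p {z = z} {w} w∈ with w ≟ z
... | yes refl = y∈p∪⁅y⁆
... | no w≢z = x∈p∪q⁺ (inj₁ (x∈p∧x≢y⇒x∈p-y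
        (x∈p∪q⁺ (inj₁ (x∈p∧x≢y⇒x∈p-y (x∈p-y⇒x∈p p w∈) w≢z))) (x∈p-y⇒x≢y p w∈)))

p[z↦x]-y⊆p-y∪⁅x⁆ : ∀ (p : Subset n) {x y z : Fin n} → p [ z ↦ x ] - y ⊆ (p - y) ∪ ⁅ x ⁆
p[z↦x]-y⊆p-y∪⁅x⁆ p w∈ with x∈p∪⁅y⁆⁻ (p - _) (x∈p-y⇒x∈p (p [ _ ↦ _ ]) w∈)
... | inj₁ w∈p-z = x∈p∪q⁺ (inj₁ (x∈p∧x≢y⇒x∈p-y (x∈p-y⇒x∈p p w∈p-z) (x∈p-y⇒x≢y (p [ _ ↦ _ ]) w∈)))
... | inj₂ refl = y∈p∪⁅y⁆

∣p∪⁅x⁆∣≡1+∣p∣ : ∀ (p : Subset n) (x : Fin n) → x ∉ p → ∣ p ∪ ⁅ x ⁆ ∣ ≡ suc ∣ p ∣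
∣p∪⁅x⁆∣≡1+∣p∣ (inside  ∷ p) Fin.zero    x∉p = ⊥-elim (x∉p here)
∣p∪⁅x⁆∣≡1+∣p∣ (outside ∷ p) Fin.zero    _   = cong (λ q → suc ∣ q ∣) (∪-identityʳ p)
∣p∪⁅x⁆∣≡1+∣p∣ (inside  ∷ p) (Fin.suc x) x∉p = cong suc (∣p∪⁅x⁆∣≡1+∣p∣ p x (λ x∈p → x∉p (there x∈p)))
∣p∪⁅x⁆∣≡1+∣p∣ (outside ∷ p) (Fin.suc x) x∉p = ∣p∪⁅x⁆∣≡1+∣p∣ p x (λ x∈p → x∉p (there x∈p))

1+∣p-x∣≡∣p∣ : ∀ (p : Subset n) (x : Fin n) → x ∈ p → suc ∣ p - x ∣ ≡ ∣ p ∣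
1+∣p-x∣≡∣p∣ (inside  ∷ p) Fin.zero    here        = cong (λ q → suc ∣ q ∣) (p─⊥≡p p)
1+∣p-x∣≡∣p∣ (inside  ∷ p) (Fin.suc x) (there x∈p) = cong suc (1+∣p-x∣≡∣p∣ p x x∈p)
1+∣p-x∣≡∣p∣ (outside ∷ p) (Fin.suc x) (there x∈p) = 1+∣p-x∣≡∣p∣ p x x∈p

∣p[y↦x]∣≡∣p∣ : ∀ (p : Subset n) {x y : Fin n} → y ∈ p → x ∉ p → ∣ p [ y ↦ x ] ∣ ≡ ∣ p ∣
∣p[y↦x]∣≡∣p∣ p {x} {y} y∈p x∉p = begin
  ∣ (p - y) ∪ ⁅ x ⁆ ∣  ≡⟨ ∣p∪⁅x⁆∣≡1+∣p∣ (p - y) x (λ x∈ → x∉p (x∈p-y⇒x∈p p x∈)) ⟩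
  suc ∣ p - y ∣       ≡⟨ 1+∣p-x∣≡∣p∣ p y y∈p ⟩
  ∣ p ∣               ∎
  where open ≡-Reasoning

module _ {ℓ : Level} {n : ℕ} (M : Matroid ℓ n) where
  open Matroid M

  dependent-⊇ : ∀ {X Y : Subset n} → Dependent M X → X ⊆ Y → Dependent M Y
  dependent-⊇ dep X⊆Y iY = dep (indep-subset X⊆Y iY)

  indep-extend : ∀ {S T : Subset n} → Indep S → Indep T →
                 ∃ λ J → S ⊆ J × J ⊆ S ∪ T × Indep J × ∣ T ∣ ≤ ∣ J ∣
  indep-extend {S} {T} iS iT = go ∣ T ∣ iS (m≤n+m ∣ T ∣ ∣ S ∣)
    where
      Extension : Subset n → Set ℓ
      Extension S = ∃ λ J → S ⊆ J × J ⊆ S ∪ T × Indep J × ∣ T ∣ ≤ ∣ J ∣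

      stop : ∀ {S} → Indep S → ∣ T ∣ ≤ ∣ S ∣ → Extension S
      stop {S} iS T≤S = S , ⊆-refl , p⊆p∪q T , iS , T≤S

      go : ∀ k {S} → Indep S → ∣ T ∣ ≤ ∣ S ∣ + k → Extension S
      go zero {S} iS T≤S = stop iS (subst (∣ T ∣ ≤_) (+-identityʳ ∣ S ∣) T≤S)
      go (suc k) {S} iS T≤S+k with ∣ T ∣ ≤? ∣ S ∣
      ... | yes T≤S = stop iS T≤S
      ... | no T≰S with indep-augment iS iT (≰⇒> T≰S)
      ...   | z , z∈T , z∉S , iSz with go k iSz (subst (λ m → ∣ T ∣ ≤ m + k)
                                        (sym (∣p∪⁅x⁆∣≡1+∣p∣ S z z∉S))
                                        (subst (∣ T ∣ ≤_) (+-suc ∣ S ∣ k) T≤S+k))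
      ...     | J , Sz⊆J , J⊆SzT , iJ , T≤J = J , ⊆-trans (p⊆p∪q _) Sz⊆J , J⊆S∪T , iJ , T≤J
        where
          J⊆S∪T : J ⊆ S ∪ T
          J⊆S∪T w∈J with x∈p∪q⁻ (S ∪ ⁅ z ⁆) T (J⊆SzT w∈J)
          ... | inj₂ w∈T = x∈p∪q⁺ (inj₂ w∈T)
          ... | inj₁ w∈Sz with x∈p∪⁅y⁆⁻ S w∈Sz
          ...   | inj₁ w∈S = x∈p∪q⁺ (inj₁ w∈S)
          ...   | inj₂ refl = x∈p∪q⁺ (inj₂ z∈T)

  indep-⊆-∣≥∣ : ∀ {J X : Subset n} → Indep J → J ⊆ X → ∣ X ∣ ≤ ∣ J ∣ → Indep X
  indep-⊆-∣≥∣ {J} iJ J⊆X X≤J = indep-subset X⊆J iJ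
    where
      X⊆J : _ ⊆ J
      X⊆J {w} w∈X with w ∈? J
      ... | yes w∈J = w∈J
      ... | no w∉J = ⊥-elim (<⇒≱ (p⊂q⇒∣p∣<∣q∣ (J⊆X , w , w∈X , w∉J)) X≤J)

  fundCircuit-∉ : ∀ {I C : Subset n} {x : Fin n} → Indep I → FundCircuit M I x C → x ∉ I
  fundCircuit-∉ iI (C⊆I , _ , (dep , _)) x∈I = dependent-⊇ dep (p⊆q∧x∈q⇒p∪⁅x⁆⊆q C⊆I x∈I) iI

  fundCircuit-∉⇒dependent : ∀ {I C : Subset n} {x y : Fin n} → FundCircuit M I x C → y ∉ C →
                            Dependent M (I [ y ↦ x ])
  fundCircuit-∉⇒dependent (C⊆I , _ , (dep , _)) y∉C =
    dependent-⊇ dep (p⊆q∧y∉p⇒p∪⁅x⁆⊆q[y↦x] C⊆I y∉C)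

  -- The circuit minus y is independent; extending it inside I yields an independent set of
  -- size ∣ I ∣ that avoids y, which must then be all of I [ y ↦ x ].
  fundCircuit-exchange : ∀ {I C : Subset n} {x y : Fin n} → Indep I → FundCircuit M I x C → y ∈ C →
                         Indep (I [ y ↦ x ])
  fundCircuit-exchange {I} {C} {x} {y} iI fc@(C⊆I , _ , (dep , minimal)) y∈C with
    indep-extend (minimal ((C ∪ ⁅ x ⁆) - y) (x∈p⇒p-x⊂p (p⊆p∪q _ y∈C))) iI
  ... | J , S⊆J , J⊆S∪I , iJ , I≤J =
    indep-⊆-∣≥∣ iJ J⊆I[y↦x] (subst (_≤ ∣ J ∣) (sym (∣p[y↦x]∣≡∣p∣ I (C⊆I y∈C) (fundCircuit-∉ iI fc))) I≤J)
    where
      y∉J : y ∉ J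
      y∉J y∈J = dependent-⊇ dep (p-y⊆q∧y∈q⇒p⊆q S⊆J y∈J) iJ

      J⊆I[y↦x] : J ⊆ I [ y ↦ x ]
      J⊆I[y↦x] w∈J with x∈p∪q⁻ _ I (J⊆S∪I w∈J)
      ... | inj₂ w∈I = p⊆p∪q _ (x∈p∧x≢y⇒x∈p-y w∈I λ { refl → y∉J w∈J })
      ... | inj₁ w∈S with x∈p∪⁅y⁆⁻ C (x∈p-y⇒x∈p _ w∈S)
      ...   | inj₁ w∈C = p⊆p∪q _ (x∈p∧x≢y⇒x∈p-y (C⊆I w∈C) (x∈p-y⇒x≢y _ w∈S))
      ...   | inj₂ refl = y∈p∪⁅y⁆

  ∈fundCircuit⇔indep-[↦] : ∀ {I C : Subset n} {x y : Fin n} → Indep I → FundCircuit M I x C →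
                            y ∈ C ⇔ Indep (I [ y ↦ x ])
  ∈fundCircuit⇔indep-[↦] {C = C} {y = y} iI fc = mk⇔ (fundCircuit-exchange iI fc) from
    where
      from : Indep _ → y ∈ C
      from i with y ∈? C
      ... | yes y∈C = y∈C
      ... | no y∉C = ⊥-elim (fundCircuit-∉⇒dependent fc y∉C i)

  ∈fundCircuit-unique : ∀ {I C D : Subset n} {x y : Fin n} → Indep I →
                        FundCircuit M I x C → FundCircuit M I x D → y ∈ C → y ∈ D
  ∈fundCircuit-unique iI fcC fcD y∈C =
    Equivalence.from (∈fundCircuit⇔indep-[↦] iI fcD) (fundCircuit-exchange iI fcC y∈C)

  -- Augmenting I by the larger J ∪ ⁅ x ⁆ ⊆ I ∪ ⁅ u , x ⁆ must add u or x, and u is excluded.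
  indep-∪⁅⁆-transfer : ∀ {I J : Subset n} {u x : Fin n} → Indep I → Indep (J ∪ ⁅ x ⁆) → x ∉ J →
                       ∣ J ∣ ≡ ∣ I ∣ → J ⊆ I ∪ ⁅ u ⁆ → Dependent M (I ∪ ⁅ u ⁆) → Indep (I ∪ ⁅ x ⁆)
  indep-∪⁅⁆-transfer {I} {J} iI iJx x∉J J≡I J⊆Iu depIu
    with indep-augment iI iJx (≤-reflexive (trans (cong suc (sym J≡I)) (sym (∣p∪⁅x⁆∣≡1+∣p∣ J _ x∉J))))
  ... | z , z∈Jx , z∉I , iIz with x∈p∪⁅y⁆⁻ J z∈Jx
  ...   | inj₂ refl = iIz
  ...   | inj₁ z∈J with x∈p∪⁅y⁆⁻ I (J⊆Iu z∈J)
  ...     | inj₁ z∈I = ⊥-elim (z∉I z∈I)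
  ...     | inj₂ refl = ⊥-elim (depIu iIz)

  indep-[↦]⇔indep-[↦][↦] : ∀ {B : Subset n} {a b x y : Fin n} →
    Indep B → Indep (B [ b ↦ a ]) → b ∈ B → a ∉ B → x ∉ B → x ≢ a → y ∈ B → y ≢ b →
    Dependent M (B [ y ↦ a ]) → Indep (B [ y ↦ x ]) ⇔ Indep (B [ b ↦ a ] [ y ↦ x ])
  indep-[↦]⇔indep-[↦][↦] {B} {a} {b} {x} {y} iB iB′ b∈B a∉B x∉B x≢a y∈B y≢b depBya =
    mk⇔ (λ iBy → indep-∪⁅⁆-transfer (indep-subset (x∈p-y⇒x∈p B′) iB′) iBy
                   (λ x∈ → x∉B (x∈p-y⇒x∈p B x∈)) (sym ∣B′-y∣≡∣B-y∣) (p-y⊆p[z↦x]-y∪⁅z⁆ B)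
                   (dependent-⊇ depBya (p⊆q∧x∈q⇒p∪⁅x⁆⊆q (p-y⊆p[z↦x]-y∪⁅z⁆ B) a∈B′-y∪b)))
        (λ iB′y → indep-∪⁅⁆-transfer (indep-subset (x∈p-y⇒x∈p B) iB) iB′y
                   x∉B′-y ∣B′-y∣≡∣B-y∣ (p[z↦x]-y⊆p-y∪⁅x⁆ B) depBya)
    where
      B′ = B [ b ↦ a ]

      a∈B′-y∪b : a ∈ (B′ - y) ∪ ⁅ b ⁆
      a∈B′-y∪b = p⊆p∪q _ (x∈p∧x≢y⇒x∈p-y y∈p∪⁅y⁆ λ { refl → a∉B y∈B })

      x∉B′-y : x ∉ B′ - y
      x∉B′-y x∈ with x∈p∪⁅y⁆⁻ (B - b) (x∈p-y⇒x∈p B′ x∈)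
      ... | inj₁ x∈B-b = x∉B (x∈p-y⇒x∈p B x∈B-b)
      ... | inj₂ x≡a = x≢a x≡a

      ∣B′-y∣≡∣B-y∣ : ∣ B′ - y ∣ ≡ ∣ B - y ∣
      ∣B′-y∣≡∣B-y∣ = suc-injective (begin
        suc ∣ B′ - y ∣  ≡⟨ 1+∣p-x∣≡∣p∣ B′ y (p⊆p∪q _ (x∈p∧x≢y⇒x∈p-y y∈B y≢b)) ⟩
        ∣ B′ ∣          ≡⟨ ∣p[y↦x]∣≡∣p∣ B b∈B a∉B ⟩
        ∣ B ∣           ≡⟨ sym (1+∣p-x∣≡∣p∣ B y y∈B) ⟩
        suc ∣ B - y ∣   ∎)
        where open ≡-Reasoning

lemma2p10 : ∀ {ℓ : Level} {n : ℕ} (M : Matroid ℓ n) (A B : Subset n) →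
  IsBase M A → IsBase M B → Disjoint A B →
  (a₁ a₂ b₁ b₂ : Fin n) → a₁ ∈ A → a₂ ∈ A → a₁ ≢ a₂ → b₁ ∈ B → b₂ ∈ B →
  IsBase M ((B - b₁) ∪ ⁅ a₁ ⁆) →
  (C₁ C₂ C₂′ : Subset n) →
  FundCircuit M B a₁ C₁ → FundCircuit M B a₂ C₂ →
  FundCircuit M ((B - b₁) ∪ ⁅ a₁ ⁆) a₂ C₂′ →
  (b₂ ∉ C₁ ⊎ b₁ ∉ C₂) →
  ((b₂ ∈ C₂′ → b₂ ∈ C₂) × (b₂ ∈ C₂ → b₂ ∈ C₂′))
lemma2p10 M A B _ (iB , _) disjoint a₁ a₂ b₁ b₂ a₁∈A a₂∈A a₁≢a₂ b₁∈B b₂∈B (iB′ , _)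
          C₁ C₂ C₂′ fc₁ fc₂@(C₂⊆B , rest₂) fc₂′ b₂∉C₁⊎b₁∉C₂ with b₁ ∈? C₂ | b₂∉C₁⊎b₁∉C₂
... | no b₁∉C₂ | _ = ∈fundCircuit-unique M iB′ fc₂′ fc₂B′ , ∈fundCircuit-unique M iB′ fc₂B′ fc₂′
  where
    fc₂B′ : FundCircuit M (B [ b₁ ↦ a₁ ]) a₂ C₂
    fc₂B′ = ⊆-trans (p⊆q∧y∉p⇒p⊆q-y C₂⊆B b₁∉C₂) (p⊆p∪q _) , rest₂
... | yes b₁∈C₂ | inj₂ b₁∉C₂ = ⊥-elim (b₁∉C₂ b₁∈C₂)
... | yes _ | inj₁ b₂∉C₁ = Equivalence.from b₂∈C₂⇔b₂∈C₂′ , Equivalence.to b₂∈C₂⇔b₂∈C₂′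
  where
    b₂≢b₁ : b₂ ≢ b₁
    b₂≢b₁ refl = b₂∉C₁ (Equivalence.from (∈fundCircuit⇔indep-[↦] M iB fc₁) iB′)

    b₂∈C₂⇔b₂∈C₂′ : b₂ ∈ C₂ ⇔ b₂ ∈ C₂′
    b₂∈C₂⇔b₂∈C₂′ =
      ⇔-trans (∈fundCircuit⇔indep-[↦] M iB fc₂)
      (⇔-trans (indep-[↦]⇔indep-[↦][↦] M iB iB′ b₁∈B (disjoint a₁ a₁∈A) (disjoint a₂ a₂∈A)
                  (λ a₂≡a₁ → a₁≢a₂ (sym a₂≡a₁)) b₂∈B b₂≢b₁ (fundCircuit-∉⇒dependent M fc₁ b₂∉C₁))
               (⇔-sym (∈fundCircuit⇔indep-[↦] M iB′ fc₂′)))
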